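{- On a uniform metric (all distinct points at distance $1$), the First-In-First-Out (FIFO) algorithm for the $k$-server (paging) problem is $(1,1)$-fair: for every request sequence $\sigma$ and every server $i$, $c_i\le \frac{\mathrm{cost}(\mathrm{FIFO},\sigma)}{k}+1$.
   Context: $k$-server problem on a uniform metric (equivalently paging): $k$ servers (cache slots) occupy points (pages); when a request arrives at a point with no server (a fault), a server must move there at cost $1$; otherwise nothing happens (lazy algorithm). $c_i$ is the total cost of server $i$ and $\mathrm{cost}=\sum_i c_i$. FIFO, on a fault, moves the server whose current page has been in the cache the longest (i.e. the server whose most recent move is oldest, with initially placed servers ordered by their placement). -}

module Defs where

open import Data.Nat using (ℕ; zero; suc; _+_; _≤?_)
open import Data.Nat.Properties using (_≟_)
open import Data.Fin using (Fin; toℕ)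
open import Data.Fin.Properties using (any?)
open import Data.List using (List; []; _∷_; map; allFin)
open import Data.Nat.ListAction using (sum)
open import Data.Product using (_×_; _,_; proj₁; proj₂)
open import Relation.Nullary using (yes; no)

-- Uniform metric: points are natural numbers (pages), any two distinct
-- points are at distance 1.  k servers are indexed by Fin k.

-- A configuration: position of every server, and the "time stamp" of the
-- server's most recent move (initially placed servers get stamp = their
-- index, i.e. they are ordered by placement: server 0 placed first).
record Config (k : ℕ) : Set where
  constructor mkConfig
  field
    pos   : Fin k → ℕ
    stamp : Fin k → ℕ
    cst   : Fin k → ℕ
open Config public

argmin : ∀ {n} → (Fin (suc n) → ℕ) → Fin (suc n)
argmin {zero}  f = Fin.zero
argmin {suc n} f with argmin {n} (λ j → f (Fin.suc j))
... | j with f Fin.zero ≤? f (Fin.suc j)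
...   | yes _ = Fin.zero
...   | no  _ = Fin.suc j

update : ∀ {k} {A : Set} → (Fin k → A) → Fin k → A → Fin k → A
update f i a j with Data.Fin._≟_ i j
... | yes _ = a
... | no  _ = f j

-- One FIFO step at time t on request r (lazy): if some server is at r,
-- nothing happens; otherwise the server whose last move is oldest
-- (minimal stamp) moves to r at cost 1.
fifoStep : ∀ {n} → ℕ → ℕ → Config (suc n) → Config (suc n)
fifoStep {n} t r C with any? (λ i → pos C i ≟ r)
... | yes _ = C
... | no  _ =
  let i = argmin (stamp C) in
  mkConfig (update (pos C) i r)
           (update (stamp C) i (suc n + t))
           (update (cst C) i (suc (cst C i)))

fifoRun : ∀ {n} → ℕ → List ℕ → Config (suc n) → Config (suc n)
fifoRun t []       C = C
fifoRun t (r ∷ σ)  C = fifoRun (suc t) σ (fifoStep t r C)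

initConfig : ∀ {n} → (Fin (suc n) → ℕ) → Config (suc n)
initConfig p = mkConfig p toℕ (λ _ → zero)

serverCost : ∀ {n} → (Fin (suc n) → ℕ) → List ℕ → Fin (suc n) → ℕ
serverCost p σ = cst (fifoRun 0 σ (initConfig p))

totalCost : ∀ {n} → (Fin (suc n) → ℕ) → List ℕ → ℕ
totalCost {n} p σ = sum (map (serverCost p σ) (allFin (suc n)))

{-# OPTIONS --safe #-}
-- FIFO always moves the server with the oldest stamp.  Invariantly, the
-- costs of any two servers differ by at most one, and a server that has
-- paid strictly more than another was moved more recently.  So the oldest
-- server is among the cheapest, and charging it keeps the costs within one
-- of each other.  Summing c i ≤ c j + 1 over all k servers j gives
-- k * c i ≤ cost + k.
module Submission where

open import Defs
open import Data.Nat using (ℕ; zero; suc; _+_; _*_; _≤_; _<_; _≤?_; z≤n)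
open import Data.Nat.Properties
open import Algebra.Properties.CommutativeSemigroup +-commutativeSemigroup using (interchange)
open import Data.Fin using (Fin; toℕ)
import Data.Fin as Fin
open import Data.Fin.Properties using (any?; toℕ<n)
open import Data.List using (List; []; _∷_; map; allFin; length)
open import Data.List.Properties using (length-tabulate)
open import Data.Nat.ListAction using (sum)
open import Relation.Nullary using (yes; no; contradiction)
open import Relation.Binary.PropositionalEquality using (_≡_; refl; sym; trans; cong; subst)
open import Function using (id)

argmin-minimal : ∀ {n} (f : Fin (suc n) → ℕ) j → f (argmin f) ≤ f j
argmin-minimal {zero}  f Fin.zero = ≤-refl
argmin-minimal {suc n} f j
  with argmin (λ j → f (Fin.suc j)) | argmin-minimal (λ j → f (Fin.suc j))
... | m | minimal with f Fin.zero ≤? f (Fin.suc m)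
argmin-minimal {suc n} f Fin.zero    | m | minimal | yes f₀≤ = ≤-refl
argmin-minimal {suc n} f (Fin.suc j) | m | minimal | yes f₀≤ = ≤-trans f₀≤ (minimal j)
argmin-minimal {suc n} f Fin.zero    | m | minimal | no  f₀≰ = <⇒≤ (≰⇒> f₀≰)
argmin-minimal {suc n} f (Fin.suc j) | m | minimal | no  f₀≰ = minimal j

sum-map-lowerBound : ∀ {A : Set} (f : A → ℕ) {c d : ℕ} → (∀ x → c ≤ f x + d) →
                     (xs : List A) → length xs * c ≤ sum (map f xs) + length xs * d
sum-map-lowerBound f c≤ []       = z≤n
sum-map-lowerBound f {c} {d} c≤ (x ∷ xs) =
  subst (length (x ∷ xs) * c ≤_) (interchange (f x) d (sum (map f xs)) (length xs * d))
        (+-mono-≤ (c≤ x) (sum-map-lowerBound f c≤ xs))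

-- stamps-past makes the stamp suc n + t of a move at time t the newest one.
record FifoInvariant {n : ℕ} (t : ℕ) (st cs : Fin (suc n) → ℕ) : Set where
  field
    stamps-past          : ∀ i → st i < suc n + t
    costs-balanced       : ∀ i j → cs i ≤ cs j + 1
    costlier-moved-later : ∀ i j → cs j < cs i → st j < st i

  oldest-cheapest : ∀ a → (∀ j → st a ≤ st j) → ∀ j → cs a ≤ cs j
  oldest-cheapest a oldest j =
    ≮⇒≥ (λ cs-j<cs-a → <⇒≱ (costlier-moved-later a j cs-j<cs-a) (oldest j))

open FifoInvariant

tick : ∀ {n t} {st cs : Fin (suc n) → ℕ} → FifoInvariant t st cs → FifoInvariant (suc t) st cs
tick {n} {t} inv = record
  { stamps-past          = λ i → <-trans (stamps-past inv i) (+-monoʳ-< (suc n) (n<1+n t))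
  ; costs-balanced       = costs-balanced inv
  ; costlier-moved-later = costlier-moved-later inv
  }

move-oldest : ∀ {n} t (st cs : Fin (suc n) → ℕ) → FifoInvariant t st cs →
              ∀ a → (∀ j → st a ≤ st j) →
              FifoInvariant (suc t) (update st a (suc n + t)) (update cs a (suc (cs a)))
move-oldest {n} t st cs inv a oldest = record
  { stamps-past          = stamps-past′
  ; costs-balanced       = costs-balanced′
  ; costlier-moved-later = costlier-moved-later′
  }
  where
  st′ cs′ : Fin (suc n) → ℕ
  st′ = update st a (suc n + t)
  cs′ = update cs a (suc (cs a))

  stamps-past′ : ∀ i → st′ i < suc n + suc t
  stamps-past′ i with a Fin.≟ i
  ... | yes _ = +-monoʳ-< (suc n) (n<1+n t)
  ... | no  _ = stamps-past (tick inv) i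

  costs-balanced′ : ∀ i j → cs′ i ≤ cs′ j + 1
  costs-balanced′ i j with a Fin.≟ i | a Fin.≟ j
  ... | yes _ | yes _ = m≤m+n _ 1
  ... | yes _ | no  _ = subst (_≤ cs j + 1) (+-comm (cs a) 1)
                              (+-monoˡ-≤ 1 (oldest-cheapest inv a oldest j))
  ... | no  _ | yes _ = ≤-trans (costs-balanced inv i a) (+-monoˡ-≤ 1 (n≤1+n _))
  ... | no  _ | no  _ = costs-balanced inv i j

  costlier-moved-later′ : ∀ i j → cs′ j < cs′ i → st′ j < st′ i
  costlier-moved-later′ i j cs′-j<cs′-i with a Fin.≟ i | a Fin.≟ j
  ... | yes _ | yes _ = contradiction cs′-j<cs′-i (<-irrefl refl)
  ... | yes _ | no  _ = stamps-past inv j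
  ... | no  _ | yes _ = contradiction (subst (cs i ≤_) (+-comm (cs a) 1) (costs-balanced inv i a))
                                      (<⇒≱ cs′-j<cs′-i)
  ... | no  _ | no  _ = costlier-moved-later inv i j cs′-j<cs′-i

fifoStep-invariant : ∀ {n} t r (C : Config (suc n)) → FifoInvariant t (stamp C) (cst C) →
                     FifoInvariant (suc t) (stamp (fifoStep t r C)) (cst (fifoStep t r C))
fifoStep-invariant t r C inv with any? (λ i → pos C i ≟ r)
... | yes _ = tick inv
... | no  _ = move-oldest t (stamp C) (cst C) inv (argmin (stamp C)) (argmin-minimal (stamp C))

fifoRun-costs-balanced : ∀ {n} t σ (C : Config (suc n)) → FifoInvariant t (stamp C) (cst C) →
                         ∀ i j → cst (fifoRun t σ C) i ≤ cst (fifoRun t σ C) j + 1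
fifoRun-costs-balanced t []      C inv = costs-balanced inv
fifoRun-costs-balanced t (r ∷ σ) C inv =
  fifoRun-costs-balanced (suc t) σ (fifoStep t r C) (fifoStep-invariant t r C inv)

initConfig-invariant : ∀ {n} (p : Fin (suc n) → ℕ) →
                       FifoInvariant 0 (stamp (initConfig p)) (cst (initConfig p))
initConfig-invariant {n} p = record
  { stamps-past          = λ i → subst (toℕ i <_) (sym (+-identityʳ (suc n))) (toℕ<n i)
  ; costs-balanced       = λ _ _ → z≤n
  ; costlier-moved-later = λ _ _ ()
  }

theorem13 : (n : ℕ) (p : Fin (suc n) → ℕ) (σ : List ℕ) (i : Fin (suc n)) →
    suc n * serverCost p σ i ≤ totalCost p σ + suc n
theorem13 n p σ i = begin
  suc n * serverCost p σ i                  ≡⟨ cong (_* serverCost p σ i) length-servers ⟨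
  length servers * serverCost p σ i         ≤⟨ sum-map-lowerBound (serverCost p σ) (costs-within-one i) servers ⟩
  totalCost p σ + length servers * 1        ≡⟨ cong (totalCost p σ +_) (trans (*-identityʳ _) length-servers) ⟩
  totalCost p σ + suc n                     ∎
  where
  open ≤-Reasoning
  servers : List (Fin (suc n))
  servers = allFin (suc n)

  length-servers : length servers ≡ suc n
  length-servers = length-tabulate id

  costs-within-one : ∀ i j → serverCost p σ i ≤ serverCost p σ j + 1
  costs-within-one = fifoRun-costs-balanced 0 σ (initConfig p) (initConfig-invariant p)
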